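{- Let $n\ge 2$. The set of circuits of the toric ideal $I_{\mathcal M}$ is exactly $$\{P_{S,T} : [n]=S\cup T \text{ is a partition of } [n] \text{ into two nonempty disjoint sets}\},\qquad P_{S,T}=\prod_{s\in S,t\in T}x_{s,t}-\prod_{s\in S,t\in T}x_{t,s}.$$
   Context: For $i\neq j$ in $[n]$, $\overline M_{i,j}$ is the real $(n-1)\times(n-1)$ matrix which is: if $i\ne n, j\ne n$, the matrix with $(i,j)$-entry $1$ and other entries $0$; if $i\ne n, j=n$, the matrix whose $i$-th row is all $-1$ and other entries $0$; if $i=n, j\ne n$, the matrix whose $j$-th column is all $-1$ and other entries $0$. Let $\mathcal M=\{\overline M_{i,j}\}$. In $k[\mathbf x]=k[x_{i,j}: i,j\in[n], i\ne j]$, for $\mathbf u\in\mathbb Z^{n(n-1)}$ indexed by ordered pairs $(i,j)$, $i\ne j$, put $\mathbf u\mathcal M=\sum_{i\ne j}\mathbf u(i,j)\overline M_{i,j}$ and write $\mathbf u=\mathbf u^+-\mathbf u^-$ with $\mathbf u^\pm\ge0$ of disjoint supports. The toric ideal is $I_{\mathcal M}=\langle\mathbf x^{\mathbf u^+}-\mathbf x^{\mathbf u^- }:\mathbf u\mathcal M=0\rangle$. A circuit of $I_{\mathcal M}$ is an irreducible binomial $\mathbf x^{\mathbf u^+}-\mathbf x^{\mathbf u^- }$ in $I_{\mathcal M}$ of minimal support (support of $\mathbf u$ = set of indices where $\mathbf u$ is nonzero). -}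

module Defs where

open import Data.Nat using (ℕ; zero; suc; pred)
open import Data.Nat.Divisibility using (_∣_)
open import Data.Integer using (ℤ; +_; -_; _+_; _*_; ∣_∣)
open import Data.Fin using (Fin; zero; suc; _≟_)
open import Data.Bool using (Bool; true; false; if_then_else_; _∧_; not)
open import Data.Maybe using (Maybe; just; nothing)
import Data.Maybe as Maybe
open import Data.Product using (Σ; _×_; _,_)
open import Relation.Binary.PropositionalEquality using (_≡_; _≢_)
open import Relation.Nullary.Decidable using (⌊_⌋)

∑ : {k : ℕ} → (Fin k → ℤ) → ℤ
∑ {zero}  f = + 0
∑ {suc k} f = f zero + ∑ (λ i → f (suc i))

-- view i = nothing  iff  i is the last element of Fin n ("i = n");
-- otherwise view i = just i, regarded as an index of Fin (n-1).
view : {n : ℕ} → Fin n → Maybe (Fin (pred n))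
view {suc zero}    zero    = nothing
view {suc (suc m)} zero    = just zero
view {suc (suc m)} (suc i) = Maybe.map suc (view i)

Mbar : {n : ℕ} → Fin n → Fin n → Fin (pred n) → Fin (pred n) → ℤ
Mbar i j a b with view i | view j
... | just i' | just j' = if ⌊ a ≟ i' ⌋ ∧ ⌊ b ≟ j' ⌋ then + 1 else + 0
... | just i' | nothing = if ⌊ a ≟ i' ⌋ then - (+ 1) else + 0
... | nothing | just j' = if ⌊ b ≟ j' ⌋ then - (+ 1) else + 0
... | nothing | nothing = + 0   -- (i = j = n : never used)

-- Integer vectors indexed by ordered pairs (i,j), i ≠ j, are encoded as
-- functions Fin n → Fin n → ℤ whose diagonal vanishes.
Vect : ℕ → Set
Vect n = Fin n → Fin n → ℤ

OffDiag : {n : ℕ} → Vect n → Set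
OffDiag u = ∀ i → u i i ≡ + 0

uM : {n : ℕ} → Vect n → Fin (pred n) → Fin (pred n) → ℤ
uM u a b = ∑ (λ i → ∑ (λ j → if ⌊ i ≟ j ⌋ then + 0 else u i j * Mbar i j a b))

InKernel : {n : ℕ} → Vect n → Set
InKernel u = ∀ a b → uM u a b ≡ + 0

NonZeroVec : {n : ℕ} → Vect n → Set
NonZeroVec u = Σ _ λ i → Σ _ λ j → u i j ≢ + 0

_⊑_ : {n : ℕ} → Vect n → Vect n → Set
u ⊑ v = ∀ i j → u i j ≢ + 0 → v i j ≢ + 0

-- gcd of the entries is 1 (equivalently x^{u+} - x^{u-} is irreducible, for u ≠ 0)
Primitive : {n : ℕ} → Vect n → Set
Primitive u = ∀ (d : ℕ) → (∀ i j → d ∣ ∣ u i j ∣) → d ≡ 1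

-- u is (the exponent vector of) a circuit of I_M: x^{u+} - x^{u-} is a nonzero
-- irreducible binomial of I_M whose support is minimal among binomials of I_M.
IsCircuit : {n : ℕ} → Vect n → Set
IsCircuit {n} u =
  OffDiag u × InKernel u × NonZeroVec u × Primitive u ×
  (∀ (v : Vect n) → OffDiag v → InKernel v → NonZeroVec v → v ⊑ u → u ⊑ v)

-- Exponent vector of P_{S,T}, T = complement of S:
-- +1 at (s,t), -1 at (t,s) for s ∈ S, t ∈ T, 0 elsewhere.
pvec : {n : ℕ} → (Fin n → Bool) → Vect n
pvec S i j =
  if S i ∧ not (S j) then + 1
  else if not (S i) ∧ S j then - (+ 1)
  else + 0

{-# OPTIONS --safe #-}

-- Using the last index n as base point, (u M)(a,b) = u(a,b) − u(a,n) − u(n,b), so u lies in the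
-- kernel exactly when u(i,j) = f(i) − f(j) for a potential f (e.g. f(i) = u(i,n)), and then
-- supp u consists of the pairs separated by the level sets of f. A kernel vector supported inside
-- supp P_{S,T} has a potential constant on S and on T, so it is a multiple of P_{S,T}. For a
-- circuit u with u(s,t) ≠ 0, the level set S of f through s gives supp P_{S,T} ⊆ supp u;
-- minimality of supp u makes u a multiple c·P_{S,T}, and primitivity forces c = ±1.

module Submission where

open import Defs
open import Data.Nat using (ℕ; _≤_; zero; suc)
open import Data.Nat.Divisibility using (_∣_; m∣m*n; ∣1⇒≡1)
open import Data.Integer using (ℤ; +_; -_; -[1+_]; _+_; _-_; _*_; ∣_∣)
import Data.Integer as ℤ
import Data.Integer.Properties as ℤ
open import Data.Integer.Tactic.RingSolver using (solve-∀)
open import Data.Fin using (Fin; zero; suc; inject₁; fromℕ; _≟_)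
import Data.Fin.Properties as Fin
import Data.Fin.Relation.Unary.Top as Top
open import Data.Fin.Relation.Unary.Top using (‵fromℕ; ‵inject₁)
open import Data.Bool using (Bool; true; false; if_then_else_; _∧_; not)
open import Data.Maybe using (just; nothing)
import Data.Maybe as Maybe
open import Data.Product using (Σ; _×_; _,_)
open import Data.Sum using (_⊎_; inj₁; inj₂; [_,_]′)
open import Function using (_∘_)
open import Relation.Binary.PropositionalEquality
  using (_≡_; _≢_; refl; sym; trans; cong; cong₂; subst; module ≡-Reasoning)
open import Relation.Nullary using (does; yes; no)
open import Relation.Nullary.Decidable using (⌊_⌋; ⌊⌋-map′; dec-true; dec-false; decidable-stable)

∑-cong : ∀ {k} {f g : Fin k → ℤ} → (∀ i → f i ≡ g i) → ∑ f ≡ ∑ g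
∑-cong {zero}  f≗g = refl
∑-cong {suc k} f≗g = cong₂ _+_ (f≗g zero) (∑-cong (f≗g ∘ suc))

∑-zero : ∀ k → ∑ {k} (λ _ → + 0) ≡ + 0
∑-zero zero    = refl
∑-zero (suc k) = trans (ℤ.+-identityˡ _) (∑-zero k)

∑-distrib-+ : ∀ {k} (f g : Fin k → ℤ) → ∑ (λ i → f i + g i) ≡ ∑ f + ∑ g
∑-distrib-+ {zero}  f g = refl
∑-distrib-+ {suc k} f g = begin
  (f zero + g zero) + ∑ (λ i → f (suc i) + g (suc i))
    ≡⟨ cong (_+_ (f zero + g zero)) (∑-distrib-+ (f ∘ suc) (g ∘ suc)) ⟩
  (f zero + g zero) + (∑ (f ∘ suc) + ∑ (g ∘ suc))
    ≡⟨ interchange (f zero) (g zero) (∑ (f ∘ suc)) (∑ (g ∘ suc)) ⟩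
  (f zero + ∑ (f ∘ suc)) + (g zero + ∑ (g ∘ suc)) ∎
  where
  open ≡-Reasoning
  interchange : ∀ a b c d → (a + b) + (c + d) ≡ (a + c) + (b + d)
  interchange = solve-∀

∑-inject₁-fromℕ : ∀ {m} (f : Fin (suc m) → ℤ) → ∑ f ≡ ∑ (f ∘ inject₁) + f (fromℕ m)
∑-inject₁-fromℕ {zero}  f = ℤ.+-comm (f zero) (+ 0)
∑-inject₁-fromℕ {suc m} f =
  trans (cong (_+_ (f zero)) (∑-inject₁-fromℕ (f ∘ suc))) (sym (ℤ.+-assoc (f zero) _ _))

∑-if : ∀ {k} (p : Bool) (f : Fin k → ℤ) →
       ∑ (λ i → if p then f i else + 0) ≡ (if p then ∑ f else + 0)
∑-if {k} true  f = refl
∑-if {k} false f = ∑-zero k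

∑-select : ∀ {k} (a : Fin k) (h : Fin k → ℤ) →
           ∑ (λ i → if ⌊ a ≟ i ⌋ then h i else + 0) ≡ h a
∑-select {suc k} zero    h = trans (cong (_+_ (h zero)) (∑-zero k)) (ℤ.+-identityʳ (h zero))
∑-select {suc k} (suc a) h = begin
  + 0 + ∑ (λ i → if ⌊ suc a ≟ suc i ⌋ then h (suc i) else + 0)
    ≡⟨ ℤ.+-identityˡ _ ⟩
  ∑ (λ i → if ⌊ suc a ≟ suc i ⌋ then h (suc i) else + 0)
    ≡⟨ ∑-cong (λ i → cong (λ b → if b then h (suc i) else + 0) (⌊suc≟suc⌋ i)) ⟩
  ∑ (λ i → if ⌊ a ≟ i ⌋ then h (suc i) else + 0)
    ≡⟨ ∑-select a (h ∘ suc) ⟩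
  h (suc a) ∎
  where
  open ≡-Reasoning
  ⌊suc≟suc⌋ : ∀ i → ⌊ suc a ≟ suc i ⌋ ≡ ⌊ a ≟ i ⌋
  ⌊suc≟suc⌋ i = ⌊⌋-map′ (cong suc) Fin.suc-injective (a ≟ i)

∑²-inject₁-fromℕ : ∀ {m} (F : Fin (suc m) → Fin (suc m) → ℤ) →
  ∑ (λ i → ∑ (F i)) ≡
    (∑ (λ a → ∑ (λ b → F (inject₁ a) (inject₁ b))) + ∑ (λ a → F (inject₁ a) (fromℕ m)))
    + (∑ (λ b → F (fromℕ m) (inject₁ b)) + F (fromℕ m) (fromℕ m))
∑²-inject₁-fromℕ {m} F = trans (∑-inject₁-fromℕ (λ i → ∑ (F i))) (cong₂ _+_
  (trans (∑-cong (λ a → ∑-inject₁-fromℕ (F (inject₁ a))))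
         (∑-distrib-+ (λ a → ∑ (λ b → F (inject₁ a) (inject₁ b))) (λ a → F (inject₁ a) (fromℕ m))))
  (∑-inject₁-fromℕ (F (fromℕ m))))

view-inject₁ : ∀ {m} (a : Fin m) → view {suc m} (inject₁ a) ≡ just a
view-inject₁ {suc zero}    zero    = refl
view-inject₁ {suc (suc m)} zero    = refl
view-inject₁ {suc (suc m)} (suc a) = cong (Maybe.map suc) (view-inject₁ a)

view-fromℕ : ∀ m → view {suc m} (fromℕ m) ≡ nothing
view-fromℕ zero    = refl
view-fromℕ (suc m) = cong (Maybe.map suc) (view-fromℕ m)

module _ {m : ℕ} (a b : Fin m) where

  Mbar-inject₁-inject₁ : ∀ a' b' → Mbar {suc m} (inject₁ a') (inject₁ b') a b
                           ≡ (if ⌊ a ≟ a' ⌋ ∧ ⌊ b ≟ b' ⌋ then + 1 else + 0)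
  Mbar-inject₁-inject₁ a' b' rewrite view-inject₁ a' | view-inject₁ b' = refl

  Mbar-inject₁-fromℕ : ∀ a' → Mbar {suc m} (inject₁ a') (fromℕ m) a b
                         ≡ (if ⌊ a ≟ a' ⌋ then - + 1 else + 0)
  Mbar-inject₁-fromℕ a' rewrite view-inject₁ a' | view-fromℕ m = refl

  Mbar-fromℕ-inject₁ : ∀ b' → Mbar {suc m} (fromℕ m) (inject₁ b') a b
                         ≡ (if ⌊ b ≟ b' ⌋ then - + 1 else + 0)
  Mbar-fromℕ-inject₁ b' rewrite view-inject₁ b' | view-fromℕ m = refl

  Mbar-fromℕ-fromℕ : Mbar {suc m} (fromℕ m) (fromℕ m) a b ≡ + 0
  Mbar-fromℕ-fromℕ rewrite view-fromℕ m = refl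

*-if-∧ : ∀ x p q →
         x * (if p ∧ q then + 1 else + 0) ≡ (if p then (if q then x else + 0) else + 0)
*-if-∧ x true  true  = ℤ.*-identityʳ x
*-if-∧ x true  false = ℤ.*-zeroʳ x
*-if-∧ x false q     = ℤ.*-zeroʳ x

*-if-neg : ∀ x p → x * (if p then - + 1 else + 0) ≡ (if p then - x else + 0)
*-if-neg x true  = trans (ℤ.*-comm x _) (ℤ.-1*i≡-i x)
*-if-neg x false = ℤ.*-zeroʳ x

uM-inject₁ : ∀ {m} (u : Vect (suc m)) → OffDiag u → ∀ a b →
  uM u a b ≡ u (inject₁ a) (inject₁ b) - u (inject₁ a) (fromℕ m) - u (fromℕ m) (inject₁ b)
uM-inject₁ {m} u off a b = begin
  uM u a b
    ≡⟨ ∑-cong (λ i → ∑-cong (drop-diagonal i)) ⟩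
  ∑ (λ i → ∑ (F i))
    ≡⟨ ∑²-inject₁-fromℕ F ⟩
  (∑ (λ a' → ∑ (λ b' → F (ι a') (ι b'))) + ∑ (λ a' → F (ι a') ℓ))
    + (∑ (λ b' → F ℓ (ι b')) + F ℓ ℓ)
    ≡⟨ cong₂ _+_ (cong₂ _+_ interior column) (cong₂ _+_ row corner) ⟩
  (u (ι a) (ι b) + - u (ι a) ℓ) + (- u ℓ (ι b) + + 0)
    ≡⟨ rearrange (u (ι a) (ι b)) (u (ι a) ℓ) (u ℓ (ι b)) ⟩
  u (ι a) (ι b) - u (ι a) ℓ - u ℓ (ι b) ∎
  where
  open ≡-Reasoning
  ι = inject₁
  ℓ = fromℕ m

  F : Fin (suc m) → Fin (suc m) → ℤ
  F i j = u i j * Mbar i j a b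

  drop-diagonal : ∀ i j → (if ⌊ i ≟ j ⌋ then + 0 else F i j) ≡ F i j
  drop-diagonal i j with i ≟ j
  ... | yes refl = cong (_* Mbar i i a b) (sym (off i))
  ... | no _     = refl

  interior : ∑ (λ a' → ∑ (λ b' → F (ι a') (ι b'))) ≡ u (ι a) (ι b)
  interior = begin
    ∑ (λ a' → ∑ (λ b' → F (ι a') (ι b')))
      ≡⟨ ∑-cong (λ a' → ∑-cong (λ b' →
           trans (cong (u (ι a') (ι b') *_) (Mbar-inject₁-inject₁ a b a' b'))
                 (*-if-∧ (u (ι a') (ι b')) ⌊ a ≟ a' ⌋ ⌊ b ≟ b' ⌋))) ⟩
    ∑ (λ a' → ∑ (λ b' → if ⌊ a ≟ a' ⌋ then δb a' b' else + 0))
      ≡⟨ ∑-cong (λ a' → trans (∑-if ⌊ a ≟ a' ⌋ (δb a'))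
                              (cong (λ x → if ⌊ a ≟ a' ⌋ then x else + 0) (∑-select b (u (ι a') ∘ ι)))) ⟩
    ∑ (λ a' → if ⌊ a ≟ a' ⌋ then u (ι a') (ι b) else + 0)
      ≡⟨ ∑-select a (λ a' → u (ι a') (ι b)) ⟩
    u (ι a) (ι b) ∎
    where
    δb : Fin m → Fin m → ℤ
    δb a' b' = if ⌊ b ≟ b' ⌋ then u (ι a') (ι b') else + 0

  column : ∑ (λ a' → F (ι a') ℓ) ≡ - u (ι a) ℓ
  column = trans (∑-cong (λ a' → trans (cong (u (ι a') ℓ *_) (Mbar-inject₁-fromℕ a b a'))
                                       (*-if-neg (u (ι a') ℓ) ⌊ a ≟ a' ⌋)))
                 (∑-select a (λ a' → - u (ι a') ℓ))

  row : ∑ (λ b' → F ℓ (ι b')) ≡ - u ℓ (ι b)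
  row = trans (∑-cong (λ b' → trans (cong (u ℓ (ι b') *_) (Mbar-fromℕ-inject₁ a b b'))
                                    (*-if-neg (u ℓ (ι b')) ⌊ b ≟ b' ⌋)))
              (∑-select b (λ b' → - u ℓ (ι b')))

  corner : F ℓ ℓ ≡ + 0
  corner = trans (cong (u ℓ ℓ *_) (Mbar-fromℕ-fromℕ a b)) (ℤ.*-zeroʳ (u ℓ ℓ))

  rearrange : ∀ x y z → (x + - y) + (- z + + 0) ≡ x - y - z
  rearrange = solve-∀

Potential : ∀ {n} → Vect n → (Fin n → ℤ) → Set
Potential u f = ∀ i j → u i j ≡ f i - f j

potential⇒OffDiag : ∀ {n} {u : Vect n} {f : Fin n → ℤ} → Potential u f → OffDiag u
potential⇒OffDiag {f = f} u≗ i = trans (u≗ i i) (ℤ.+-inverseʳ (f i))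

potential⇒InKernel : ∀ {m} {u : Vect (suc m)} {f : Fin (suc m) → ℤ} →
                     Potential u f → InKernel u
potential⇒InKernel {m} {u} {f} u≗ a b = begin
  uM u a b
    ≡⟨ uM-inject₁ u (potential⇒OffDiag {f = f} u≗) a b ⟩
  u (ι a) (ι b) - u (ι a) ℓ - u ℓ (ι b)
    ≡⟨ cong₂ _-_ (cong₂ _-_ (u≗ (ι a) (ι b)) (u≗ (ι a) ℓ)) (u≗ ℓ (ι b)) ⟩
  (f (ι a) - f (ι b)) - (f (ι a) - f ℓ) - (f ℓ - f (ι b))
    ≡⟨ telescope (f (ι a)) (f (ι b)) (f ℓ) ⟩
  + 0 ∎
  where
  open ≡-Reasoning
  ι = inject₁
  ℓ = fromℕ m
  telescope : ∀ x y z → (x - y) - (x - z) - (z - y) ≡ + 0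
  telescope = solve-∀

module _ {m : ℕ} {u : Vect (suc m)} (off : OffDiag u) (ker : InKernel u) where
  private
    ι = inject₁
    ℓ = fromℕ m

    kernel-entry : ∀ a b → u (ι a) (ι b) - u (ι a) ℓ ≡ u ℓ (ι b)
    kernel-entry a b = ℤ.i-j≡0⇒i≡j _ _ (trans (sym (uM-inject₁ u off a b)) (ker a b))

    antisymmetric : ∀ a → u ℓ (ι a) ≡ - u (ι a) ℓ
    antisymmetric a = begin
      u ℓ (ι a)                  ≡⟨ sym (kernel-entry a a) ⟩
      u (ι a) (ι a) - u (ι a) ℓ  ≡⟨ cong (_+ - u (ι a) ℓ) (off (ι a)) ⟩
      + 0 - u (ι a) ℓ            ≡⟨ ℤ.+-identityˡ (- u (ι a) ℓ) ⟩
      - u (ι a) ℓ                ∎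
      where open ≡-Reasoning

    interior : ∀ a b → u (ι a) (ι b) ≡ u (ι a) ℓ - u (ι b) ℓ
    interior a b = begin
      u (ι a) (ι b)                           ≡⟨ add-sub (u (ι a) (ι b)) (u (ι a) ℓ) ⟩
      u (ι a) ℓ + (u (ι a) (ι b) - u (ι a) ℓ) ≡⟨ cong (_+_ (u (ι a) ℓ)) (kernel-entry a b) ⟩
      u (ι a) ℓ + u ℓ (ι b)                   ≡⟨ cong (_+_ (u (ι a) ℓ)) (antisymmetric b) ⟩
      u (ι a) ℓ - u (ι b) ℓ                   ∎
      where
      open ≡-Reasoning
      add-sub : ∀ x y → x ≡ y + (x - y)
      add-sub = solve-∀

  InKernel⇒potential : Potential u (λ k → u k (fromℕ m))
  InKernel⇒potential i j with Top.view i | Top.view j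
  ... | ‵inject₁ a | ‵inject₁ b = interior a b
  ... | ‵inject₁ a | ‵fromℕ     =
    sym (trans (cong (_+_ (u (ι a) ℓ) ∘ -_) (off ℓ)) (ℤ.+-identityʳ (u (ι a) ℓ)))
  ... | ‵fromℕ     | ‵inject₁ b =
    trans (antisymmetric b) (sym (trans (cong (_+ - u (ι b) ℓ) (off ℓ)) (ℤ.+-identityˡ (- u (ι b) ℓ))))
  ... | ‵fromℕ     | ‵fromℕ     = trans (off ℓ) (sym (ℤ.+-inverseʳ (u ℓ ℓ)))

potential-zero⇒≡ : ∀ {n} {v : Vect n} {g : Fin n → ℤ} → Potential v g →
                   ∀ {i j} → v i j ≡ + 0 → g i ≡ g j
potential-zero⇒≡ {g = g} v≗ {i} {j} v≡0 = ℤ.i-j≡0⇒i≡j (g i) (g j) (trans (sym (v≗ i j)) v≡0)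

≡⇒potential-zero : ∀ {n} {v : Vect n} {g : Fin n → ℤ} → Potential v g →
                   ∀ {i j} → g i ≡ g j → v i j ≡ + 0
≡⇒potential-zero {g = g} v≗ {i} {j} g≡ = trans (v≗ i j) (ℤ.i≡j⇒i-j≡0 g≡)

indicator : ∀ {n} → (Fin n → Bool) → Fin n → ℤ
indicator S i = if S i then + 1 else + 0

module _ {n : ℕ} (S : Fin n → Bool) where

  pvec-potential : Potential (pvec S) (indicator S)
  pvec-potential i j with S i | S j
  ... | true  | true  = refl
  ... | true  | false = refl
  ... | false | true  = refl
  ... | false | false = refl

  pvec-not : ∀ i j → pvec (not ∘ S) i j ≡ - pvec S i j
  pvec-not i j with S i | S j
  ... | true  | true  = refl
  ... | true  | false = refl
  ... | false | true  = refl
  ... | false | false = refl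

  pvec-zero : ∀ {i j} → S i ≡ S j → pvec S i j ≡ + 0
  pvec-zero S≡ = ≡⇒potential-zero pvec-potential (cong (if_then + 1 else + 0) S≡)

  pvec-one : ∀ {s t} → S s ≡ true → S t ≡ false → pvec S s t ≡ + 1
  pvec-one Ss St rewrite Ss | St = refl

  pvec-nonzero : ∀ {s t} → S s ≡ true → S t ≡ false → pvec S s t ≢ + 0
  pvec-nonzero Ss St p≡0 with () ← trans (sym (pvec-one Ss St)) p≡0

  ⊑pvec⇒multiple : ∀ {v : Vect n} {g : Fin n → ℤ} {s t} → Potential v g →
                   S s ≡ true → S t ≡ false → v ⊑ pvec S → ∀ i j → v i j ≡ v s t * pvec S i j
  ⊑pvec⇒multiple {v} {g} {s} {t} v≗ Ss St v⊑ i j = begin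
    v i j
      ≡⟨ v≗ i j ⟩
    g i - g j
      ≡⟨ cong₂ _-_ (level i) (level j) ⟩
    (g t + c * indicator S i) - (g t + c * indicator S j)
      ≡⟨ factor (g t) c (indicator S i) (indicator S j) ⟩
    c * (indicator S i - indicator S j)
      ≡⟨ cong₂ _*_ (sym (v≗ s t)) (sym (pvec-potential i j)) ⟩
    v s t * pvec S i j ∎
    where
    open ≡-Reasoning
    c = g s - g t

    constant-on-blocks : ∀ a b → S a ≡ S b → g a ≡ g b
    constant-on-blocks a b S≡ = potential-zero⇒≡ v≗
      (decidable-stable (v a b ℤ.≟ + 0) (λ v≢0 → v⊑ a b v≢0 (pvec-zero S≡)))

    level : ∀ k → g k ≡ g t + c * indicator S k
    level k with S k in Sk
    ... | true  = trans (constant-on-blocks k s (trans Sk (sym Ss))) (shift (g s) (g t))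
      where
      shift : ∀ x y → x ≡ y + (x - y) * + 1
      shift = solve-∀
    ... | false = trans (constant-on-blocks k t (trans Sk (sym St))) (keep (g t) c)
      where
      keep : ∀ x y → x ≡ x + y * + 0
      keep = solve-∀

    factor : ∀ x y a b → (x + y * a) - (x + y * b) ≡ y * (a - b)
    factor = solve-∀

IsPartitionVector : ∀ {n} → Vect n → Set
IsPartitionVector {n} u =
  Σ (Fin n → Bool) λ S → (Σ (Fin n) λ s → S s ≡ true) × (Σ (Fin n) λ t → S t ≡ false) ×
    (∀ i j → u i j ≡ pvec S i j)

primitive-multiple⇒unit : ∀ {n} {u w : Vect n} (c : ℤ) →
                          Primitive u → (∀ i j → u i j ≡ c * w i j) → ∣ c ∣ ≡ 1
primitive-multiple⇒unit {u = u} {w} c prim u≗ = prim ∣ c ∣ λ i j →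
  subst (∣ c ∣ ∣_) (sym (trans (cong ∣_∣ (u≗ i j)) (ℤ.abs-* c (w i j)))) (m∣m*n ∣ w i j ∣)

∣i∣≡1⇒i≡±1 : ∀ i → ∣ i ∣ ≡ 1 → i ≡ + 1 ⊎ i ≡ - + 1
∣i∣≡1⇒i≡±1 (+ .1)       refl = inj₁ refl
∣i∣≡1⇒i≡±1 -[1+ zero ] refl = inj₂ refl

unit-multiple-of-pvec⇒partition : ∀ {n} {u : Vect n} (S : Fin n → Bool) {s t} (c : ℤ) →
  S s ≡ true → S t ≡ false → ∣ c ∣ ≡ 1 → (∀ i j → u i j ≡ c * pvec S i j) →
  IsPartitionVector u
unit-multiple-of-pvec⇒partition S {s} {t} c Ss St ∣c∣≡1 u≗ with ∣i∣≡1⇒i≡±1 c ∣c∣≡1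
... | inj₁ refl = S , (s , Ss) , (t , St) , λ i j → trans (u≗ i j) (ℤ.*-identityˡ (pvec S i j))
... | inj₂ refl = not ∘ S , (t , cong not St) , (s , cong not Ss) , λ i j →
  trans (u≗ i j) (trans (ℤ.-1*i≡-i (pvec S i j)) (sym (pvec-not S i j)))

circuit⇒partition : ∀ {m} {u : Vect (suc m)} → IsCircuit u → IsPartitionVector u
circuit⇒partition {m} {u} (off , ker , (s , t , u≢0) , prim , minimal) =
  unit-multiple-of-pvec⇒partition S (u s t) Ss St ∣c∣≡1 u≗c·pvec
  where
  f : Fin (suc m) → ℤ
  f k = u k (fromℕ m)

  u≗ : Potential u f
  u≗ = InKernel⇒potential off ker

  S : Fin (suc m) → Bool
  S k = does (f k ℤ.≟ f s)

  Ss : S s ≡ true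
  Ss = dec-true (f s ℤ.≟ f s) refl

  St : S t ≡ false
  St = dec-false (f t ℤ.≟ f s) (λ f≡ → u≢0 (≡⇒potential-zero {g = f} u≗ (sym f≡)))

  pvec⊑u : pvec S ⊑ u
  pvec⊑u i j p≢0 u≡0 =
    p≢0 (pvec-zero S (cong (λ x → does (x ℤ.≟ f s)) (potential-zero⇒≡ {g = f} u≗ u≡0)))

  u⊑pvec : u ⊑ pvec S
  u⊑pvec = minimal (pvec S) (potential⇒OffDiag {f = indicator S} (pvec-potential S))
                   (potential⇒InKernel {f = indicator S} (pvec-potential S))
                   (s , t , pvec-nonzero S Ss St) pvec⊑u

  u≗c·pvec : ∀ i j → u i j ≡ u s t * pvec S i j
  u≗c·pvec = ⊑pvec⇒multiple S {g = f} u≗ Ss St u⊑pvec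

  ∣c∣≡1 : ∣ u s t ∣ ≡ 1
  ∣c∣≡1 = primitive-multiple⇒unit (u s t) prim u≗c·pvec

partition⇒circuit : ∀ {m} {u : Vect (suc m)} → IsPartitionVector u → IsCircuit u
partition⇒circuit {m} {u} (S , (s , Ss) , (t , St) , u≗pvec) =
  potential⇒OffDiag {f = indicator S} u≗ , potential⇒InKernel {f = indicator S} u≗ ,
  (s , t , u≢0) , prim , minimal
  where
  u≗ : Potential u (indicator S)
  u≗ i j = trans (u≗pvec i j) (pvec-potential S i j)

  u≢0 : u s t ≢ + 0
  u≢0 = subst (_≢ + 0) (sym (u≗pvec s t)) (pvec-nonzero S Ss St)

  prim : Primitive u
  prim d d∣ = ∣1⇒≡1 (subst (d ∣_) (cong ∣_∣ (trans (u≗pvec s t) (pvec-one S Ss St))) (d∣ s t))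

  minimal : ∀ v → OffDiag v → InKernel v → NonZeroVec v → v ⊑ u → u ⊑ v
  minimal v off ker (s′ , t′ , v≢0) v⊑u i j u≢0 v≡0 =
    [ c≢0 , (λ p≡0 → u≢0 (trans (u≗pvec i j) p≡0)) ]′
      (ℤ.i*j≡0⇒i≡0∨j≡0 (v s t) (trans (sym (v≗ i j)) v≡0))
    where
    v≗ : ∀ i j → v i j ≡ v s t * pvec S i j
    v≗ = ⊑pvec⇒multiple S {g = λ k → v k (fromℕ m)} (InKernel⇒potential off ker) Ss St
           (λ i j v≢0 → subst (_≢ + 0) (u≗pvec i j) (v⊑u i j v≢0))

    c≢0 : v s t ≢ + 0
    c≢0 c≡0 = v≢0 (trans (v≗ s′ t′) (cong (_* pvec S s′ t′) c≡0))

proposition3p6 : (n : ℕ) → 2 ≤ n → (u : Vect n) →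
    (IsCircuit u →
      Σ (Fin n → Bool) λ S → (Σ (Fin n) λ s → S s ≡ true) × (Σ (Fin n) λ t → S t ≡ false) ×
        (∀ i j → u i j ≡ pvec S i j))
    × ((Σ (Fin n → Bool) λ S → (Σ (Fin n) λ s → S s ≡ true) × (Σ (Fin n) λ t → S t ≡ false) ×
        (∀ i j → u i j ≡ pvec S i j)) → IsCircuit u)
proposition3p6 (suc m) _ u = circuit⇒partition , partition⇒circuit
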